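{- Let $G$ be a graph and $k$ a nonnegative integer such that $|N(u)\setminus N[v]|\geq k$ for all $u,v\in V(G)$. Then $\mathrm{thin}(G)\geq k+1$. Moreover, for every ordering $<$ of $V(G)$, the first $k+1$ vertices in the ordering induce a complete graph in $G_<$.
   Context: Graphs are finite, simple, undirected. $N(v)$ is the open neighborhood of $v$ and $N[v]=N(v)\cup\{v\}$. For a graph $G=(V,E)$, an ordering $v_1,\dots,v_n$ of $V$ and a partition of $V$ are consistent if for every $r<s<t$, whenever $v_r,v_s$ are in the same class and $v_tv_r\in E$, then $v_tv_s\in E$. $\mathrm{thin}(G)$ is the minimum number of classes of a partition of $V$ consistent with some ordering of $V$. For an ordering $<$ of $V(G)$, $G_<$ is the graph with vertex set $V(G)$ in which, for $v<w$, $vw$ is an edge iff there is a vertex $z$ with $w<z$, $zv\in E(G)$ and $zw\notin E(G)$. -}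

module Defs where

open import Data.Nat using (ℕ; _<_)
open import Data.Fin using (Fin)
open import Data.Fin.Subset using (Subset; ∣_∣; _∈_; _∉_)
open import Data.Product using (_×_; Σ)
open import Relation.Nullary using (¬_; Dec)
open import Relation.Binary.PropositionalEquality using (_≡_)
open import Function.Bundles using (_↔_; Inverse)
open import Data.Vec using (tabulate)
open import Data.Bool using (Bool; true; false; _∧_; not)
open import Relation.Nullary.Decidable using (⌊_⌋)
open import Level using (0ℓ)

record Graph (n : ℕ) : Set₁ where
  field
    Adj     : Fin n → Fin n → Set
    adj?    : ∀ u v → Dec (Adj u v)
    sym     : ∀ {u v} → Adj u v → Adj v u
    irrefl  : ∀ {u} → ¬ Adj u u
open Graph public

N : ∀ {n} → Graph n → Fin n → Subset n
N G v = tabulate λ w → ⌊ adj? G v w ⌋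

open import Data.Fin using (_≟_)
N∖N[] : ∀ {n} → Graph n → Fin n → Fin n → Subset n
N∖N[] G u v = tabulate λ w → ⌊ adj? G u w ⌋ ∧ not ⌊ adj? G v w ⌋ ∧ not ⌊ w ≟ v ⌋

-- An ordering of V(G): a bijection pos : Fin n ↔ Fin n, vertex ↦ position.
Ordering : ℕ → Set
Ordering n = Fin n ↔ Fin n

_≺[_]_ : ∀ {n} → Fin n → Ordering n → Fin n → Set
v ≺[ o ] w = Data.Fin._<_ (Inverse.to o v) (Inverse.to o w)

-- A partition of V into m classes: a surjective class map c : Fin n → Fin m
-- (surjective = every class nonempty).
IsPartition : ∀ {n m} → (Fin n → Fin m) → Set
IsPartition {n} {m} c = ∀ (j : Fin m) → Σ (Fin n) λ v → c v ≡ j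

Consistent : ∀ {n m} → Graph n → Ordering n → (Fin n → Fin m) → Set
Consistent G o c = ∀ r s t → r ≺[ o ] s → s ≺[ o ] t → c r ≡ c s →
                   Adj G t r → Adj G t s

ThinAtLeast : ∀ {n} → Graph n → ℕ → Set
ThinAtLeast {n} G k = ∀ (m : ℕ) (o : Ordering n) (c : Fin n → Fin m) →
  IsPartition c → Consistent G o c → k Data.Nat.≤ m

-- Edges of G_< : for v < w, vw is an edge iff ∃ z with w < z, zv ∈ E, zw ∉ E.
-- (defined for ordered pair v < w; G_< as an undirected graph is its symmetrisation)
AdjOrd : ∀ {n} → Graph n → Ordering n → Fin n → Fin n → Set
AdjOrd G o v w = v ≺[ o ] w × Σ (Fin _) λ z → w ≺[ o ] z × Adj G z v × ¬ Adj G z w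

at : ∀ {n} → Ordering n → Fin n → Fin n
at o i = Inverse.from o i

module Submission where

-- Fix an ordering and two positions i < j ≤ k, with vertices
-- v = at i and w = at j.  The set N(v) ∖ N[w] has at least k elements, none
-- of which is v or w, so together with v and w it yields k + 2 distinct
-- vertices.  These cannot all sit at positions ≤ j, since there are only
-- j + 1 ≤ k + 1 such positions; hence some z ∈ N(v) ∖ N[w] comes after w,
-- and z witnesses the edge vw of G_<.  So the first k + 1 vertices form a
-- clique in G_< (the second claim).  In a consistent partition, the two ends
-- v < w of an edge of G_< lie in different classes: otherwise its witness z,
-- adjacent to v, would be adjacent to w as well.  Hence the first k + 1
-- vertices lie in pairwise different classes, and thin(G) ≥ k + 1.  (That
-- there are k + 1 vertices at all is the same counting argument for any
-- pair u ≠ v, which exists as n ≥ 2.)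

open import Defs hiding (sym)
open import Data.Nat using (ℕ; _≤_; _<_; zero; suc; s≤s; s≤s⁻¹)
import Data.Nat.Properties as ℕ
open import Data.Fin using (Fin; toℕ; fromℕ<; inject≤; _≟_)
import Data.Fin as Fin
import Data.Fin.Properties as Fin
open import Data.Fin.Subset using (Subset; ∣_∣; _∈_; inside; outside)
open import Data.Fin.Subset.Properties using (_∈?_)
open import Data.Vec using (_∷_; here; there)
open import Data.Vec.Properties using (lookup∘tabulate; []=⇒lookup)
open import Data.Vec.Functional using (Vector) renaming (_∷_ to _◂_)
open import Data.Bool using (true; _∧_; not)
open import Data.Product using (_×_; _,_; proj₁; proj₂)
open import Relation.Nullary using (¬_; yes; no; _×-dec_)
open import Relation.Nullary.Decidable using (⌊_⌋)
open import Relation.Binary using (tri<; tri≈; tri>)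
open import Relation.Binary.PropositionalEquality
  using (_≡_; _≢_; refl; sym; trans; cong; subst; subst₂; module ≡-Reasoning)
open import Function.Bundles using (Inverse; Injection)
open import Function.Definitions using (Injective)
open import Function.Properties.Inverse using (↔⇒↣; ↔-sym)
open import Data.Empty using (⊥-elim)
open import Data.Unit using (⊤; tt)

record DistinctFamily {A : Set} (k : ℕ) (P : A → Set) : Set where
  field
    elem      : Vector A k
    injective : Injective _≡_ _≡_ elem
    property  : ∀ x → P (elem x)
open DistinctFamily

prepend : ∀ {A : Set} {k} {P : A → Set} (u : A) (F : DistinctFamily k P) →
          P u → (∀ x → elem F x ≢ u) → DistinctFamily (suc k) P
prepend u F Pu fresh = record
  { elem      = u ◂ elem F
  ; injective = λ {x} {y} → inj x y
  ; property  = λ { Fin.zero → Pu ; (Fin.suc x) → property F x }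
  }
  where
  inj : ∀ x y → (u ◂ elem F) x ≡ (u ◂ elem F) y → x ≡ y
  inj Fin.zero    Fin.zero    _  = refl
  inj Fin.zero    (Fin.suc y) eq = ⊥-elim (fresh y (sym eq))
  inj (Fin.suc x) Fin.zero    eq = ⊥-elim (fresh x eq)
  inj (Fin.suc x) (Fin.suc y) eq = cong Fin.suc (injective F eq)

shift : ∀ {n k s} {S : Subset n} → DistinctFamily k (_∈ S) → DistinctFamily k (_∈ s ∷ S)
shift F = record
  { elem      = λ x → Fin.suc (elem F x)
  ; injective = λ eq → injective F (Fin.suc-injective eq)
  ; property  = λ x → there (property F x)
  }

enumerate : ∀ {n k} (S : Subset n) → k ≤ ∣ S ∣ → DistinctFamily k (_∈ S)
enumerate {k = zero}  S             _           =
  record { elem = λ () ; injective = λ {} ; property = λ () }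
enumerate             (outside ∷ S) k≤∣S∣       = shift (enumerate S k≤∣S∣)
enumerate {k = suc k} (inside ∷ S)  (s≤s k≤∣S∣) =
  prepend Fin.zero (shift (enumerate S k≤∣S∣)) here (λ _ ())

weaken : ∀ {A : Set} {k} {P Q : A → Set} → (∀ {z} → P z → Q z) →
         DistinctFamily k P → DistinctFamily k Q
weaken P⇒Q F = record
  { elem = elem F ; injective = injective F ; property = λ x → P⇒Q (property F x) }

pos : ∀ {n} → Ordering n → Fin n → ℕ
pos o v = toℕ (Inverse.to o v)

module _ {n : ℕ} (o : Ordering n) where
  open Inverse o using (strictlyInverseˡ)

  pos-at : ∀ i → pos o (at o i) ≡ toℕ i
  pos-at i = cong toℕ (strictlyInverseˡ i)

  at-injective : Injective _≡_ _≡_ (at o)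
  at-injective = Injection.injective (↔⇒↣ (↔-sym o))

  boundedPositions : ∀ {m j} → DistinctFamily m (λ z → pos o z ≤ j) → m ≤ suc j
  boundedPositions {j = j} F = Fin.injective⇒≤ {f = slot} slot-injective
    where
    slot : Fin _ → Fin (suc j)
    slot x = fromℕ< (s≤s (property F x))

    slot-injective : Injective _≡_ _≡_ slot
    slot-injective {x} {y} eq = injective F (Injection.injective (↔⇒↣ o)
      (Fin.toℕ-injective (begin
        pos o (elem F x)  ≡⟨ sym (Fin.toℕ-fromℕ< (s≤s (property F x))) ⟩
        toℕ (slot x)      ≡⟨ cong toℕ eq ⟩
        toℕ (slot y)      ≡⟨ Fin.toℕ-fromℕ< (s≤s (property F y)) ⟩
        pos o (elem F y)  ∎)))
      where open ≡-Reasoning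

PrivateNeighbourBound : ∀ {n} → Graph n → ℕ → Set
PrivateNeighbourBound {n} G k = ∀ (u v : Fin n) → ¬ u ≡ v → k ≤ ∣ N∖N[] G u v ∣

InitialClique : ∀ {n} → Graph n → ℕ → Set
InitialClique {n} G k = ∀ (o : Ordering n) (i j : Fin n) → toℕ i < toℕ j → toℕ j < suc k →
  AdjOrd G o (at o i) (at o j)

privateNeighbour : ∀ {n} (G : Graph n) {u v z} → z ∈ N∖N[] G u v →
                   Adj G u z × ¬ Adj G v z × z ≢ v
privateNeighbour G {u} {v} {z} z∈S =
  decode (trans (sym (lookup∘tabulate _ z)) ([]=⇒lookup z∈S))
  where
  decode : ⌊ adj? G u z ⌋ ∧ not ⌊ adj? G v z ⌋ ∧ not ⌊ z ≟ v ⌋ ≡ true →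
           Adj G u z × ¬ Adj G v z × z ≢ v
  decode _ with adj? G u z | adj? G v z | z ≟ v
  ... | yes uz | no ¬vz | no z≢v = uz , ¬vz , z≢v
  decode () | no _  | _     | _
  decode () | yes _ | yes _ | _
  decode () | yes _ | no _  | yes _

privateNeighbour≢ : ∀ {n} (G : Graph n) {u v z} → z ∈ N∖N[] G u v → z ≢ u
privateNeighbour≢ G z∈S refl = irrefl G (proj₁ (privateNeighbour G z∈S))

withPrivateNeighbours : ∀ {n k} (G : Graph n) {u v} (P : Fin n → Set) →
  u ≢ v → k ≤ ∣ N∖N[] G u v ∣ → P u → P v → (∀ {z} → z ∈ N∖N[] G u v → P z) →
  DistinctFamily (suc (suc k)) P
withPrivateNeighbours G {u} {v} P u≢v k≤∣S∣ Pu Pv P-on-S =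
  prepend u (prepend v (weaken P-on-S F) Pv fresh-v) Pu fresh-u
  where
  F : DistinctFamily _ (_∈ N∖N[] G u v)
  F = enumerate (N∖N[] G u v) k≤∣S∣

  fresh-v : ∀ x → elem F x ≢ v
  fresh-v x = proj₂ (proj₂ (privateNeighbour G (property F x)))

  fresh-u : ∀ x → (v ◂ elem F) x ≢ u
  fresh-u Fin.zero    = λ v≡u → u≢v (sym v≡u)
  fresh-u (Fin.suc x) = privateNeighbour≢ G (property F x)

enoughVertices : ∀ {n k} (G : Graph n) → 2 ≤ n → PrivateNeighbourBound G k → suc k ≤ n
enoughVertices {suc (suc _)} G (s≤s (s≤s _)) hyp =
  ℕ.<⇒≤ (Fin.injective⇒≤ {f = elem vertices} (injective vertices))
  where
  vertices : DistinctFamily _ (λ _ → ⊤)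
  vertices = withPrivateNeighbours G (λ _ → ⊤) (λ ())
               (hyp Fin.zero (Fin.suc Fin.zero) (λ ())) tt tt (λ _ → tt)

-- For positions i < j ≤ k with v = at o i and w = at o j: if no
-- member of N(v) ∖ N[w] came after w, then v, w and k such members would be
-- k + 2 distinct vertices in the j + 1 ≤ k + 1 first positions.
initialClique : ∀ {n k} (G : Graph n) → PrivateNeighbourBound G k → InitialClique G k
initialClique {k = k} G hyp o i j i<j j<1+k
  with Fin.any? (λ z → (z ∈? N∖N[] G (at o i) (at o j)) ×-dec (toℕ j ℕ.<? pos o z))
... | yes (z , z∈S , j<z) = v≺w , z , w≺z , Graph.sym G vz , λ wz → ¬wz (Graph.sym G wz)
  where
  vz : Adj G (at o i) z
  vz = proj₁ (privateNeighbour G z∈S)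
  ¬wz : ¬ Adj G (at o j) z
  ¬wz = proj₁ (proj₂ (privateNeighbour G z∈S))
  v≺w : at o i ≺[ o ] at o j
  v≺w = subst₂ _<_ (sym (pos-at o i)) (sym (pos-at o j)) i<j
  w≺z : at o j ≺[ o ] z
  w≺z = subst (_< pos o z) (sym (pos-at o j)) j<z
... | no noneAfter = ⊥-elim (ℕ.<⇒≱ j<1+k (s≤s⁻¹ (boundedPositions o early)))
  where
  v≢w : at o i ≢ at o j
  v≢w eq = ℕ.<-irrefl (cong toℕ (at-injective o eq)) i<j
  early : DistinctFamily (suc (suc k)) (λ z → pos o z ≤ toℕ j)
  early = withPrivateNeighbours G _ v≢w (hyp _ _ v≢w)
    (subst (_≤ toℕ j) (sym (pos-at o i)) (ℕ.<⇒≤ i<j))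
    (ℕ.≤-reflexive (pos-at o j))
    (λ {z} z∈S → ℕ.≮⇒≥ (λ j<z → noneAfter (z , z∈S , j<z)))

-- The two ends v < w of an edge of G_< lie in different classes of a consistent
-- partition: otherwise the witness z, adjacent to v, would be adjacent to w.
separatesClasses : ∀ {n m} (G : Graph n) (o : Ordering n) (c : Fin n → Fin m) →
  Consistent G o c → ∀ {v w} → AdjOrd G o v w → c v ≢ c w
separatesClasses G o c consistent (v≺w , z , w≺z , zv , ¬zw) same =
  ¬zw (consistent _ _ z v≺w w≺z same zv)

separating⇒injective : ∀ {m} {A : Set} (f : Fin m → A) →
  (∀ {x y} → x Fin.< y → f x ≢ f y) → Injective _≡_ _≡_ f
separating⇒injective f separated {x} {y} eq with Fin.<-cmp x y
... | tri< x<y _   _   = ⊥-elim (separated x<y eq)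
... | tri≈ _   x≡y _   = x≡y
... | tri> _   _   y<x = ⊥-elim (separated y<x (sym eq))

thinFromInitialClique : ∀ {n} (G : Graph n) (k : ℕ) (k<n : suc k ≤ n) →
  InitialClique G k → ThinAtLeast G (suc k)
thinFromInitialClique G k k<n clique m o c _ consistent =
  Fin.injective⇒≤ {f = class} (separating⇒injective class separated)
  where
  vertex : Fin (suc k) → Fin _
  vertex x = at o (inject≤ x k<n)

  class : Fin (suc k) → Fin m
  class x = c (vertex x)

  separated : ∀ {x y} → x Fin.< y → class x ≢ class y
  separated {x} {y} x<y = separatesClasses G o c consistent (clique o _ _
    (subst₂ _<_ (sym (Fin.toℕ-inject≤ x k<n)) (sym (Fin.toℕ-inject≤ y k<n)) x<y)
    (subst (_< suc k) (sym (Fin.toℕ-inject≤ y k<n)) (Fin.toℕ<n y)))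

theorem3p7 : ∀ {n} (G : Graph n) (k : ℕ) → 2 ≤ n →
    (∀ (u v : Fin n) → ¬ u ≡ v → k ≤ ∣ N∖N[] G u v ∣) →
    ThinAtLeast G (suc k)
    × (∀ (o : Ordering n) (i j : Fin n) → toℕ i < toℕ j → toℕ j < suc k →
         AdjOrd G o (at o i) (at o j))
theorem3p7 G k 2≤n hyp =
  thinFromInitialClique G k (enoughVertices G 2≤n hyp) (initialClique G hyp) ,
  initialClique G hyp
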